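{- There exist infinitely many squarefree integers $D>1$ with $-D\equiv 1\pmod 4$ for which the ring of integers $\mathcal{O}_K$ of the imaginary quadratic field $K=\mathbb{Q}(\sqrt{ -D})$ contains a nonzero ideal $I$ such that $\Lambda_K(I)$ is WR.
   Context: For an imaginary quadratic field $K$, fix a complex embedding $\tau$ and define $\sigma:K\to\mathbb{R}^2$, $\sigma(x)=(\Re\tau(x),\Im\tau(x))$; $\Lambda_K(I)=\sigma(I)$. A full-rank lattice $\Lambda\subset\mathbb{R}^2$ is well-rounded (WR) if its set of minimal vectors $S(\Lambda)=\{x\in\Lambda:\|x\|^2=\min_{y\in\Lambda\setminus\{0\}}\|y\|^2\}$ (Euclidean norm) spans $\mathbb{R}^2$. -}

module Defs where

open import Level using (0ℓ)
open import Data.Nat as ℕ using (ℕ)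
import Data.Nat.DivMod as ℕD
open import Data.Integer using (ℤ; +_; _+_; _-_; _*_; -_; 0ℤ)
open import Data.Integer.Divisibility using () renaming (_∣_ to _∣ℤ_)
open import Data.Nat.Divisibility using (_∣_)
open import Data.Product using (_×_; _,_; Σ; ∃; ∃-syntax)
open import Relation.Binary.PropositionalEquality using (_≡_)
open import Relation.Nullary using (¬_)
open import Data.Nat using (_≤_)
import Data.Integer as Z

SquareFree : ℕ → Set
SquareFree D = ∀ n → (n ℕ.* n) ∣ D → n ≡ 1

NegCong1Mod4 : ℕ → Set
NegCong1Mod4 D = (+ 4) ∣ℤ ((- (+ D)) - (+ 1))

-- For -D ≡ 1 mod 4, O_K = ℤ[ω], ω = (1 + √-D)/2, ω² = ω - (D+1)/4.
-- An element a + bω of O_K is represented by the pair (a , b).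
OK : Set
OK = ℤ × ℤ

m : ℕ → ℤ
m D = + (ℕ.suc D ℕD./ 4)

_⊕_ : OK → OK → OK
(a , b) ⊕ (c , d) = (a + c , b + d)

-- (a+bω)(c+dω) = ac - bd·(D+1)/4 + (ad + bc + bd)ω
mul : ℕ → OK → OK → OK
mul D (a , b) (c , d) = (a * c - b * d * m D , a * d + b * c + b * d)

zeroO : OK
zeroO = (0ℤ , 0ℤ)

record IsNonzeroIdeal (D : ℕ) (I : OK → Set) : Set where
  field
    has-zero : I zeroO
    add-closed : ∀ x y → I x → I y → I (x ⊕ y)
    mul-closed : ∀ r x → I x → I (mul D r x)
    nonzero : ∃[ x ] (I x × ¬ (x ≡ zeroO))

-- With τ(ω) = (1 + i√D)/2, σ(a+bω) = (a + b/2 , b√D/2), so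
-- 4·‖σ(a+bω)‖² = (2a+b)² + D b²  (an integer; we use this exact value).
norm4 : ℕ → OK → ℤ
norm4 D (a , b) = (a + a + b) * (a + a + b) + (+ D) * b * b

-- σ(x), σ(y) are ℝ-linearly independent iff
-- det [[a₁ + b₁/2, b₁√D/2],[a₂ + b₂/2, b₂√D/2]] = (√D/2)(a₁b₂ - a₂b₁) ≠ 0.
Independent : OK → OK → Set
Independent (a₁ , b₁) (a₂ , b₂) = ¬ (a₁ * b₂ - a₂ * b₁ ≡ 0ℤ)

Minimal : ℕ → (OK → Set) → OK → Set
Minimal D I x = I x × ¬ (x ≡ zeroO) ×
  (∀ z → I z → ¬ (z ≡ zeroO) → norm4 D x Z.≤ norm4 D z)

-- Λ_K(I) is well-rounded: S(Λ_K(I)) spans ℝ², i.e. it contains two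
-- linearly independent vectors.
WR : ℕ → (OK → Set) → Set
WR D I = ∃[ x ] ∃[ y ] (Minimal D I x × Minimal D I y × Independent x y)

{-# OPTIONS --safe #-}
-- Take D = (1 + 2a)(3 + 2a), so that 1 + D = 4A² with A = 1 + a.  Then -D ≡ 1 (mod 4), the norm
-- of ω is (1 + D)/4 = A², and Aℤ + ℤω is an ideal containing A and ω, two independent vectors of
-- squared length A²; every other nonzero element of the ideal is at least as long, so it is WR.
--
-- It remains to find infinitely many a with D squarefree.  The factors 1 + 2a and 3 + 2a are odd
-- and coprime, so D is squarefree unless some (3 + 2j)² divides one of them, with j < K as soon as
-- 3 + 2a < (3 + 2K)².  For fixed j these a form two residue classes of density below
-- 1/(2(1+j)(2+j)), and these densities telescope to less than 1/2.  So for K = N + 3 the sieve by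
-- all j < K cannot remove all a ∈ [N, 2K²).
module Submission where

open import Defs
open import Level using (Level)
open import Function using (_∘_; case_of_)
open import Data.Product using (Σ; ∃-syntax; _×_; _,_; proj₁)
open import Data.Sum using (_⊎_; inj₁; inj₂; [_,_])
open import Data.List using ([]; _∷_)
open import Data.List.Relation.Unary.All using (_∷_)
open import Data.Nat
open import Data.Nat.Properties
open import Data.Nat.Divisibility
open import Data.Nat.DivMod using (m*n/n≡m)
open import Data.Nat.ListAction using (product)
open import Data.Nat.Coprimality using (Coprime; coprime-divisor) renaming (sym to coprime-sym)
open import Data.Nat.Primality using (Prime; euclidsLemma; prime⇒nonZero; ¬prime[1])
open import Data.Nat.Primality.Factorisation using (factorise)
open import Data.Nat.Tactic.RingSolver using (solve-∀)
open import Data.Integer as ℤ using (ℤ; +_; 0ℤ)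
import Data.Integer.Properties as ℤₚ
import Data.Integer.Divisibility.Signed as ℤ∣
import Data.Integer.Tactic.RingSolver as ℤSolver
open import Algebra.Properties.CommutativeSemigroup *-commutativeSemigroup using (xy∙z≈y∙xz)
open import Relation.Nullary using (¬_; yes; no; contradiction)
open import Relation.Unary using (Pred; Decidable; _⊆_; Empty)
open import Relation.Unary.Properties using (_∪?_)
open import Relation.Binary.PropositionalEquality using (_≡_; _≢_; refl; sym; trans; cong; cong₂; subst; subst₂; module ≡-Reasoning)

-- Counting in initial segments of ℕ

private variable
  ℓ ℓ′ : Level
  P : Pred ℕ ℓ
  Q : Pred ℕ ℓ′

count : Decidable P → ℕ → ℕ
count P? zero = 0
count P? (suc M) with P? M
... | yes _ = suc (count P? M)
... | no  _ = count P? M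

count-mono : (P? : Decidable P) (Q? : Decidable Q) → P ⊆ Q → ∀ M → count P? M ≤ count Q? M
count-mono P? Q? P⊆Q zero = z≤n
count-mono P? Q? P⊆Q (suc M) with P? M | Q? M
... | yes _  | yes _ = s≤s (count-mono P? Q? P⊆Q M)
... | yes PM | no ¬QM = contradiction (P⊆Q PM) ¬QM
... | no _   | yes _ = m≤n⇒m≤1+n (count-mono P? Q? P⊆Q M)
... | no _   | no _  = count-mono P? Q? P⊆Q M

count-∪ : (P? : Decidable P) (Q? : Decidable Q) → ∀ M → count (P? ∪? Q?) M ≤ count P? M + count Q? M
count-∪ P? Q? zero = z≤n
count-∪ P? Q? (suc M) with P? M | Q? M
... | yes _ | yes _ = s≤s (≤-trans (count-∪ P? Q? M) (+-monoʳ-≤ _ (n≤1+n _)))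
... | yes _ | no _  = s≤s (count-∪ P? Q? M)
... | no _  | yes _ = ≤-trans (s≤s (count-∪ P? Q? M)) (≤-reflexive (sym (+-suc _ _)))
... | no _  | no _  = count-∪ P? Q? M

count-∅ : (P? : Decidable P) → Empty P → ∀ M → count P? M ≡ 0
count-∅ P? ∅ zero = refl
count-∅ P? ∅ (suc M) with P? M
... | yes PM = contradiction PM (∅ M)
... | no _   = count-∅ P? ∅ M

sumBelow : (ℕ → ℕ) → ℕ → ℕ
sumBelow c zero = 0
sumBelow c (suc K) = sumBelow c K + c K

count-∃< : {P : ℕ → ℕ → Set ℓ} (P? : ∀ j → Decidable (P j)) → ∀ K M →
           count (λ a → anyUpTo? (λ j → P? j a) K) M ≤ sumBelow (λ j → count (P? j) M) K
count-∃< P? zero M = ≤-reflexive (count-∅ _ (λ { _ (_ , () , _) }) M)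
count-∃< {P = P} P? (suc K) M = begin
  count (λ a → anyUpTo? (λ j → P? j a) (suc K)) M
    ≤⟨ count-mono _ ((λ a → anyUpTo? (λ j → P? j a) K) ∪? P? K) split M ⟩
  count ((λ a → anyUpTo? (λ j → P? j a) K) ∪? P? K) M
    ≤⟨ count-∪ _ (P? K) M ⟩
  count (λ a → anyUpTo? (λ j → P? j a) K) M + count (P? K) M
    ≤⟨ +-monoˡ-≤ _ (count-∃< P? K M) ⟩
  sumBelow (λ j → count (P? j) M) (suc K) ∎
  where
  open ≤-Reasoning
  split : ∀ {a} → ∃[ j ] (j < suc K × P j a) → ∃[ j ] (j < K × P j a) ⊎ P K a
  split (j , j<1+K , Pja) with m<1+n⇒m<n∨m≡n j<1+K
  ... | inj₁ j<K  = inj₁ (j , j<K , Pja)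
  ... | inj₂ refl = inj₂ Pja

count-gap : (P? : Decidable P) → ∀ N M → N + count P? M < M → ∃[ a ] (N ≤ a × a < M × ¬ P a)
count-gap P? N (suc M) N+c<1+M with P? M
... | no ¬PM = M , m+n≤o⇒m≤o N (s≤s⁻¹ N+c<1+M) , ≤-refl , ¬PM
... | yes _ with count-gap P? N M (s≤s⁻¹ (≤-trans (≤-reflexive (cong suc (sym (+-suc N _)))) N+c<1+M))
...   | a , N≤a , a<M , ¬Pa = a , N≤a , m<n⇒m<1+n a<M , ¬Pa

Sparse : ℕ → Pred ℕ ℓ → Set ℓ
Sparse w P = ∀ {a b} → P a → P b → a < b → a + w ≤ b

count-sparse : (P? : Decidable P) → ∀ {w} → Sparse w P → ∀ M → w * count P? M ≤ M + w
count-sparse {P = P} P? {w} sparse M = [ none , last ] (lastHit M)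
  where
  lastHit : ∀ M → count P? M ≡ 0 ⊎ ∃[ h ] (h < M × P h × w * count P? M ≤ h + w)
  lastHit zero = inj₁ refl
  lastHit (suc M) with P? M | lastHit M
  ... | no _  | inj₁ c≡0 = inj₁ c≡0
  ... | no _  | inj₂ (h , h<M , Ph , bound) = inj₂ (h , m<n⇒m<1+n h<M , Ph , bound)
  ... | yes PM | inj₁ c≡0 = inj₂ (M , ≤-refl , PM , (begin
    w * suc (count P? M) ≡⟨ cong (λ c → w * suc c) c≡0 ⟩
    w * 1                ≡⟨ *-identityʳ w ⟩
    w                    ≤⟨ m≤n+m w M ⟩
    M + w                ∎))
    where open ≤-Reasoning
  ... | yes PM | inj₂ (h , h<M , Ph , bound) = inj₂ (M , ≤-refl , PM , (begin
    w * suc (count P? M) ≡⟨ *-suc w _ ⟩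
    w + w * count P? M   ≤⟨ +-monoʳ-≤ w bound ⟩
    w + (h + w)          ≤⟨ +-monoʳ-≤ w (sparse Ph PM h<M) ⟩
    w + M                ≡⟨ +-comm w M ⟩
    M + w                ∎))
    where open ≤-Reasoning
  none : count P? M ≡ 0 → w * count P? M ≤ M + w
  none c≡0 = ≤-trans (≤-reflexive (trans (cong (w *_) c≡0) (*-zeroʳ w))) z≤n
  last : ∃[ h ] (h < M × P h × w * count P? M ≤ h + w) → w * count P? M ≤ M + w
  last (h , h<M , _ , bound) = ≤-trans bound (+-monoˡ-≤ w (<⇒≤ h<M))

-- Σ_{j<K} 1/((1+j)(2+j)) telescopes to K/(1+K).
telescope : (c : ℕ → ℕ) (X Y : ℕ) → (∀ j → (1 + j) * (2 + j) * c j ≤ X + (1 + j) * (2 + j) * Y) →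
            ∀ K → (1 + K) * sumBelow c K ≤ K * (X + (1 + K) * Y)
telescope c X Y bound zero = z≤n
telescope c X Y bound (suc K) = *-cancelˡ-≤ (1 + K) (begin
  (1 + K) * ((2 + K) * (sumBelow c K + c K))
    ≡⟨ expand (sumBelow c K) (c K) K ⟩
  (2 + K) * ((1 + K) * sumBelow c K) + (1 + K) * (2 + K) * c K
    ≤⟨ +-mono-≤ (*-monoʳ-≤ (2 + K) (telescope c X Y bound K)) (bound K) ⟩
  (2 + K) * (K * (X + (1 + K) * Y)) + (X + (1 + K) * (2 + K) * Y)
    ≡⟨ collect X Y K ⟩
  (1 + K) * ((1 + K) * (X + (2 + K) * Y)) ∎)
  where
  open ≤-Reasoning
  expand : ∀ S c K → (1 + K) * ((2 + K) * (S + c)) ≡ (2 + K) * ((1 + K) * S) + (1 + K) * (2 + K) * c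
  expand = solve-∀
  collect : ∀ X Y K → (2 + K) * (K * (X + (1 + K) * Y)) + (X + (1 + K) * (2 + K) * Y) ≡ (1 + K) * ((1 + K) * (X + (2 + K) * Y))
  collect = solve-∀

-- Squarefree products of consecutive odd numbers

even⊎odd : ∀ n → ∃[ k ] n ≡ 2 * k ⊎ ∃[ k ] n ≡ 1 + 2 * k
even⊎odd zero = inj₁ (0 , refl)
even⊎odd (suc n) with even⊎odd n
... | inj₁ (k , refl) = inj₂ (k , refl)
... | inj₂ (k , refl) = inj₁ (suc k , sym (*-suc 2 k))

odd-coprime-2 : ∀ t → Coprime (1 + 2 * t) 2
odd-coprime-2 t {d} (d∣odd , d∣2) =
  ∣1⇒≡1 (∣m+n∣m⇒∣n (subst (d ∣_) (+-comm 1 (2 * t)) d∣odd) (∣m⇒∣m*n t d∣2))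

consecutive-odd-coprime : ∀ t → Coprime (1 + 2 * t) (3 + 2 * t)
consecutive-odd-coprime t {d} (d∣u , d∣v) =
  odd-coprime-2 t (d∣u , ∣m+n∣m⇒∣n (subst (d ∣_) (+-comm 2 (1 + 2 * t)) d∣v) d∣u)

prime-square-divides-factor : ∀ {u v p} → Coprime u v → Prime p → p * p ∣ u * v → p ∣ u → p * p ∣ u
prime-square-divides-factor {v = v} {p} coprime p-prime p²∣uv (divides-refl u′)
  with euclidsLemma u′ v p-prime (*-cancelˡ-∣ p {{prime⇒nonZero p-prime}} (subst (p * p ∣_) (xy∙z≈y∙xz u′ p v) p²∣uv))
... | inj₁ p∣u′ = subst (p * p ∣_) (*-comm p u′) (*-monoʳ-∣ p p∣u′)
... | inj₂ p∣v  = contradiction (subst Prime (coprime (n∣m*n u′ , p∣v)) p-prime) ¬prime[1]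

coprime-square-split : ∀ {u v p} → Coprime u v → Prime p → p * p ∣ u * v → p * p ∣ u ⊎ p * p ∣ v
coprime-square-split {u} {v} {p} coprime p-prime p²∣uv with euclidsLemma u v p-prime (m*n∣⇒m∣ p p p²∣uv)
... | inj₁ p∣u = inj₁ (prime-square-divides-factor coprime p-prime p²∣uv p∣u)
... | inj₂ p∣v = inj₂ (prime-square-divides-factor (coprime-sym coprime) p-prime (subst (p * p ∣_) (*-comm u v) p²∣uv) p∣v)

noPrimeSquare⇒squareFree : ∀ {D} .{{_ : NonZero D}} → (∀ {p} → Prime p → ¬ p * p ∣ D) → SquareFree D
noPrimeSquare⇒squareFree {D} noPrimeSquare zero 0∣D = contradiction (0∣⇒≡0 0∣D) (≢-nonZero⁻¹ D)
noPrimeSquare⇒squareFree noPrimeSquare 1 _ = refl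
noPrimeSquare⇒squareFree noPrimeSquare n@(2+ _) n²∣D with factorise n
... | record { factors = [] ; isFactorisation = () }
... | record { factors = p ∷ ps ; isFactorisation = n≡p*ps ; factorsPrime = p-prime ∷ _ } =
  contradiction (∣-trans (*-pres-∣ p∣n p∣n) n²∣D) (noPrimeSquare p-prime)
  where
  p∣n : p ∣ n
  p∣n = divides (product ps) (trans n≡p*ps (*-comm p _))

oddSq : ℕ → ℕ
oddSq j = (3 + 2 * j) * (3 + 2 * j)

odd-prime-divisor : ∀ {p x} → Prime p → p ∣ 1 + 2 * x → ∃[ j ] p ≡ 3 + 2 * j
odd-prime-divisor {p} {x} p-prime p∣odd with even⊎odd p
... | inj₁ (k , refl)     = contradiction (odd-coprime-2 x (∣-trans (m∣m*n k) p∣odd , ∣-refl)) λ ()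
... | inj₂ (zero , refl)  = contradiction p-prime ¬prime[1]
... | inj₂ (suc j , refl) = j , cong suc (*-suc 2 j)

small-prime-square⇒oddSq∣ : ∀ {p x K} → Prime p → p * p ∣ 1 + 2 * x → 1 + 2 * x < oddSq K →
                            ∃[ j ] (j < K × oddSq j ∣ 1 + 2 * x)
small-prime-square⇒oddSq∣ {x = x} {K} p-prime p²∣ small with odd-prime-divisor {x = x} p-prime (m*n∣⇒m∣ _ _ p²∣)
... | j , refl = j , ≰⇒> (λ K≤j → <⇒≱ small (≤-trans (*-mono-≤ (3+2∙-mono K≤j) (3+2∙-mono K≤j)) (∣⇒≤ p²∣))) , p²∣
  where
  3+2∙-mono : ∀ {j k} → j ≤ k → 3 + 2 * j ≤ 3 + 2 * k
  3+2∙-mono j≤k = +-monoʳ-≤ 3 (*-monoʳ-≤ 2 j≤k)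

OddSqDivides : ℕ → ℕ → Set
OddSqDivides j a = oddSq j ∣ 1 + 2 * a ⊎ oddSq j ∣ 3 + 2 * a

oddSqDivides? : ∀ j → Decidable (OddSqDivides j)
oddSqDivides? j = (λ a → oddSq j ∣? 1 + 2 * a) ∪? (λ a → oddSq j ∣? 3 + 2 * a)

Sieved : ℕ → ℕ → Set
Sieved K a = ∃[ j ] (j < K × OddSqDivides j a)

sieved? : ∀ K → Decidable (Sieved K)
sieved? K a = anyUpTo? (λ j → oddSqDivides? j a) K

unsieved⇒squareFree : ∀ {a} K → 3 + 2 * a < oddSq K → ¬ Sieved K a →
                      SquareFree ((1 + 2 * a) * (3 + 2 * a))
unsieved⇒squareFree {a} K small unsieved = noPrimeSquare⇒squareFree λ p-prime p²∣D →
  [ no-square-1+2a p-prime , no-square-3+2a p-prime ] (coprime-square-split (consecutive-odd-coprime a) p-prime p²∣D)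
  where
  3+2a≡ : 1 + 2 * (1 + a) ≡ 3 + 2 * a
  3+2a≡ = cong suc (*-suc 2 a)
  no-square-1+2a : ∀ {p} → Prime p → ¬ p * p ∣ 1 + 2 * a
  no-square-1+2a p-prime p²∣ with small-prime-square⇒oddSq∣ {x = a} {K} p-prime p²∣ (<-trans (n<1+n _) (<-trans (n<1+n _) small))
  ... | j , j<K , d = unsieved (j , j<K , inj₁ d)
  no-square-3+2a : ∀ {p} → Prime p → ¬ p * p ∣ 3 + 2 * a
  no-square-3+2a {p} p-prime p²∣
    with small-prime-square⇒oddSq∣ {x = 1 + a} {K} p-prime (subst (p * p ∣_) (sym 3+2a≡) p²∣) (subst (_< oddSq K) (sym 3+2a≡) small)
  ... | j , j<K , d = unsieved (j , j<K , inj₂ (subst (oddSq j ∣_) 3+2a≡ d))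

odd-multiples-sparse : ∀ {q} c → Coprime q 2 → Sparse q (λ a → q ∣ c + 2 * a)
odd-multiples-sparse {q} c coprime {a} {b} q∣a q∣b a<b = begin
  a + q         ≤⟨ +-monoʳ-≤ a (∣⇒≤ {{>-nonZero (m<n⇒0<n∸m a<b)}} q∣b∸a) ⟩
  a + (b ∸ a)   ≡⟨ m+[n∸m]≡n (<⇒≤ a<b) ⟩
  b             ∎
  where
  open ≤-Reasoning
  shift : c + 2 * b ≡ (c + 2 * a) + 2 * (b ∸ a)
  shift = trans (cong (λ b → c + 2 * b) (sym (m+[n∸m]≡n (<⇒≤ a<b)))) (distrib c a (b ∸ a))
    where
    distrib : ∀ c a d → c + 2 * (a + d) ≡ (c + 2 * a) + 2 * d
    distrib = solve-∀
  q∣b∸a : q ∣ b ∸ a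
  q∣b∸a = coprime-divisor coprime (∣m+n∣m⇒∣n (subst (q ∣_) shift q∣b) q∣a)

oddSq≡ : ∀ j → (3 + 2 * j) * (3 + 2 * j) ≡ 1 + 2 * (2 * ((1 + j) * (2 + j)))
oddSq≡ = solve-∀

oddSq-coprime-2 : ∀ j → Coprime (oddSq j) 2
oddSq-coprime-2 j = subst (λ n → Coprime n 2) (sym (oddSq≡ j)) (odd-coprime-2 (2 * ((1 + j) * (2 + j))))

-- (3 + 2j)² = 1 + 4(1+j)(2+j), so each of the two residue classes has density below 1/(4(1+j)(2+j)).
count-oddSqDivides : ∀ K j → (1 + j) * (2 + j) * count (oddSqDivides? j) (2 * K * K) ≤ K * K + 1 + (1 + j) * (2 + j) * 2
count-oddSqDivides K j = *-cancelˡ-≤ 4 (begin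
  4 * (w * c)                   ≡⟨ regroup w c ⟩
  2 * (2 * w) * c               ≤⟨ *-monoˡ-≤ c (n≤1+n (2 * (2 * w))) ⟩
  (1 + 2 * (2 * w)) * c         ≡⟨ cong (_* c) (oddSq≡ j) ⟨
  oddSq j * c                   ≤⟨ *-monoʳ-≤ (oddSq j) (count-∪ _ _ M) ⟩
  oddSq j * (c₁ + c₃)           ≡⟨ *-distribˡ-+ (oddSq j) c₁ c₃ ⟩
  oddSq j * c₁ + oddSq j * c₃   ≤⟨ +-mono-≤ (count-sparse _ (odd-multiples-sparse 1 (oddSq-coprime-2 j)) M)
                                             (count-sparse _ (odd-multiples-sparse 3 (oddSq-coprime-2 j)) M) ⟩
  (M + oddSq j) + (M + oddSq j) ≤⟨ m≤m+n _ 2 ⟩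
  (M + oddSq j) + (M + oddSq j) + 2 ≡⟨ collect K j ⟩
  4 * (K * K + 1 + (1 + j) * (2 + j) * 2) ∎)
  where
  open ≤-Reasoning
  w  = (1 + j) * (2 + j)
  M  = 2 * K * K
  c  = count (oddSqDivides? j) M
  c₁ = count (λ a → oddSq j ∣? 1 + 2 * a) M
  c₃ = count (λ a → oddSq j ∣? 3 + 2 * a) M
  regroup : ∀ w c → 4 * (w * c) ≡ 2 * (2 * w) * c
  regroup = solve-∀
  collect : ∀ K j → (2 * K * K + (3 + 2 * j) * (3 + 2 * j)) + (2 * K * K + (3 + 2 * j) * (3 + 2 * j)) + 2
                  ≡ 4 * (K * K + 1 + (1 + j) * (2 + j) * 2)
  collect = solve-∀

below-threshold : ∀ {a} K → a < 2 * K * K → 3 + 2 * a < oddSq K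
below-threshold {a} K a<M = begin-strict
  3 + 2 * a           ≡⟨ cong suc (*-suc 2 a) ⟨
  1 + 2 * (1 + a)     ≤⟨ +-monoʳ-≤ 1 (*-monoʳ-≤ 2 a<M) ⟩
  1 + 2 * (2 * K * K) <⟨ m<m+n _ (s≤s z≤n) ⟩
  1 + 2 * (2 * K * K) + (8 + 12 * K) ≡⟨ expand K ⟩
  oddSq K             ∎
  where
  open ≤-Reasoning
  expand : ∀ K → 1 + 2 * (2 * K * K) + (8 + 12 * K) ≡ (3 + 2 * K) * (3 + 2 * K)
  expand = solve-∀

few-sieved : ∀ N → let K = 3 + N; M = 2 * K * K in N + count (sieved? K) M < M
few-sieved N = *-cancelˡ-< (1 + K) _ _ (begin-strict
  (1 + K) * (N + count (sieved? K) M)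
    ≡⟨ *-distribˡ-+ (1 + K) N _ ⟩
  (1 + K) * N + (1 + K) * count (sieved? K) M
    ≤⟨ +-monoʳ-≤ ((1 + K) * N) (*-monoʳ-≤ (1 + K) (count-∃< oddSqDivides? K M)) ⟩
  (1 + K) * N + (1 + K) * sumBelow (λ j → count (oddSqDivides? j) M) K
    ≤⟨ +-monoʳ-≤ ((1 + K) * N) (telescope _ (K * K + 1) 2 (count-oddSqDivides K) K) ⟩
  (1 + K) * N + K * (K * K + 1 + (1 + K) * 2)
    <⟨ m<m+n _ (s≤s z≤n) ⟩
  (1 + K) * N + K * (K * K + 1 + (1 + K) * 2) + (18 + 20 * N + 8 * N * N + N * N * N)
    ≡⟨ slack N ⟩
  (1 + K) * M ∎)
  where
  open ≤-Reasoning
  K = 3 + N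
  M = 2 * K * K
  slack : ∀ N → (4 + N) * N + (3 + N) * ((3 + N) * (3 + N) + 1 + (4 + N) * 2) + (18 + 20 * N + 8 * N * N + N * N * N)
              ≡ (4 + N) * (2 * (3 + N) * (3 + N))
  slack = solve-∀

∃-squareFree-oddPair : ∀ N → ∃[ a ] (N ≤ a × SquareFree ((1 + 2 * a) * (3 + 2 * a)))
∃-squareFree-oddPair N = conclude (count-gap (sieved? K) N (2 * K * K) (few-sieved N))
  where
  K = 3 + N
  conclude : ∃[ a ] (N ≤ a × a < 2 * K * K × ¬ Sieved K a) → ∃[ a ] (N ≤ a × SquareFree ((1 + 2 * a) * (3 + 2 * a)))
  conclude (a , N≤a , a<M , unsieved) = a , N≤a , unsieved⇒squareFree {a} K (below-threshold K a<M) unsieved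

-- The lattice of the ideal Aℤ + ℤω

∣_∣² : ℤ → ℕ
∣ i ∣² = ℤ.∣ i ∣ * ℤ.∣ i ∣

ℤ-square : ∀ i → i ℤ.* i ≡ + ∣ i ∣²
ℤ-square (+ n)      = sym (ℤₚ.pos-* n n)
ℤ-square ℤ.-[1+ n ] = refl

norm4≡ : ∀ D c y → norm4 D (c , y) ≡ + (∣ c ℤ.+ c ℤ.+ y ∣² + D * ∣ y ∣²)
norm4≡ D c y = cong₂ ℤ._+_ (ℤ-square (c ℤ.+ c ℤ.+ y)) (begin
  + D ℤ.* y ℤ.* y     ≡⟨ ℤₚ.*-assoc (+ D) y y ⟩
  + D ℤ.* (y ℤ.* y)   ≡⟨ cong (+ D ℤ.*_) (ℤ-square y) ⟩
  + D ℤ.* + ∣ y ∣²    ≡⟨ ℤₚ.pos-* D _ ⟨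
  + (D * ∣ y ∣²)      ∎)
  where open ≡-Reasoning

2c+y≡0⇒2∣y : ∀ c y → c ℤ.+ c ℤ.+ y ≡ 0ℤ → + 2 ℤ∣.∣ y
2c+y≡0⇒2∣y c y eq = ℤ∣.divides (ℤ.- c) (begin
  y                                     ≡⟨ identity c y ⟩
  (c ℤ.+ c ℤ.+ y) ℤ.+ (ℤ.- c) ℤ.* + 2   ≡⟨ cong (ℤ._+ (ℤ.- c) ℤ.* + 2) eq ⟩
  0ℤ ℤ.+ (ℤ.- c) ℤ.* + 2                ≡⟨ ℤₚ.+-identityˡ _ ⟩
  (ℤ.- c) ℤ.* + 2                       ∎)
  where
  open ≡-Reasoning
  identity : ∀ c y → y ≡ (c ℤ.+ c ℤ.+ y) ℤ.+ (ℤ.- c) ℤ.* + 2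
  identity = ℤSolver.solve-∀

∣y∣≡1⇒1≤∣2c+y∣² : ∀ c y → ℤ.∣ y ∣ ≡ 1 → 1 ≤ ∣ c ℤ.+ c ℤ.+ y ∣²
∣y∣≡1⇒1≤∣2c+y∣² c y ∣y∣≡1 with ℤ.∣ c ℤ.+ c ℤ.+ y ∣ in ∣s∣≡0
... | suc _ = s≤s z≤n
... | zero  with ℤ∣.∣⇒∣ᵤ (2c+y≡0⇒2∣y c y (ℤₚ.∣i∣≡0⇒i≡0 ∣s∣≡0))
...   | 2∣∣y∣ with ∣⇒≤ (subst (2 ∣_) ∣y∣≡1 2∣∣y∣)
...     | s≤s ()

module _ {D A : ℕ} .{{_ : NonZero A}} (1+D≡4A² : 1 + D ≡ 4 * (A * A)) where

  Aℤ+ℤω : OK → Set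
  Aℤ+ℤω (c , _) = + A ℤ∣.∣ c

  m≡A² : m D ≡ + A ℤ.* + A
  m≡A² = begin
    + (suc D / 4)       ≡⟨ cong (λ n → + (n / 4)) (trans 1+D≡4A² (*-comm 4 (A * A))) ⟩
    + (A * A * 4 / 4)   ≡⟨ cong +_ (m*n/n≡m (A * A) 4) ⟩
    + (A * A)           ≡⟨ ℤₚ.pos-* A A ⟩
    + A ℤ.* + A         ∎
    where open ≡-Reasoning

  negCong1Mod4 : NegCong1Mod4 D
  negCong1Mod4 = divides (A * A) (begin
    ℤ.∣ ℤ.- (+ D) ℤ.- + 1 ∣ ≡⟨ abs D ⟩
    1 + D                 ≡⟨ 1+D≡4A² ⟩
    4 * (A * A)           ≡⟨ *-comm 4 (A * A) ⟩
    A * A * 4             ∎)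
    where
    open ≡-Reasoning
    abs : ∀ n → ℤ.∣ ℤ.- (+ n) ℤ.- + 1 ∣ ≡ 1 + n
    abs zero    = refl
    abs (suc n) = cong (λ k → 2 + k) (+-identityʳ n)

  Aℤ+ℤω-isNonzeroIdeal : IsNonzeroIdeal D Aℤ+ℤω
  Aℤ+ℤω-isNonzeroIdeal = record
    { has-zero   = ℤ∣.divides 0ℤ refl
    ; add-closed = λ _ _ → ℤ∣.∣m∣n⇒∣m+n
    ; mul-closed = λ { (r , s) (c , d) A∣c → ℤ∣.∣m∣n⇒∣m-n (ℤ∣.∣n⇒∣m*n r A∣c)
        (ℤ∣.∣n⇒∣m*n (s ℤ.* d) (subst (+ A ℤ∣.∣_) (sym m≡A²) (ℤ∣.∣m⇒∣m*n (+ A) ℤ∣.∣-refl))) }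
    ; nonzero    = (0ℤ , + 1) , ℤ∣.divides 0ℤ refl , λ ()
    }

  1≤D : 1 ≤ D
  1≤D = ≤-trans (s≤s z≤n) (s≤s⁻¹ (begin
    4               ≡⟨ *-identityʳ 4 ⟨
    4 * 1           ≤⟨ *-monoʳ-≤ 4 (>-nonZero⁻¹ (A * A) {{m*n≢0 A A}}) ⟩
    4 * (A * A)     ≡⟨ 1+D≡4A² ⟨
    1 + D           ∎))
    where open ≤-Reasoning

  A∣c⇒1+D≤∣2c∣² : ∀ {c} → + A ℤ∣.∣ c → c ≢ 0ℤ → 1 + D ≤ ∣ c ℤ.+ c ℤ.+ 0ℤ ∣²
  A∣c⇒1+D≤∣2c∣² {c} A∣c c≢0 = begin
    1 + D                         ≡⟨ trans 1+D≡4A² (4A²≡[2A]² A) ⟩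
    (2 * A) * (2 * A)             ≤⟨ *-mono-≤ 2A≤ 2A≤ ⟩
    (2 * ℤ.∣ c ∣) * (2 * ℤ.∣ c ∣) ≡⟨ cong (λ k → k * k) ∣2c∣≡ ⟨
    ∣ c ℤ.+ c ℤ.+ 0ℤ ∣²           ∎
    where
    open ≤-Reasoning
    4A²≡[2A]² : ∀ A → 4 * (A * A) ≡ (2 * A) * (2 * A)
    4A²≡[2A]² = solve-∀
    2A≤ : 2 * A ≤ 2 * ℤ.∣ c ∣
    2A≤ = *-monoʳ-≤ 2 (∣⇒≤ {{≢-nonZero (c≢0 ∘ ℤₚ.∣i∣≡0⇒i≡0)}} (ℤ∣.∣⇒∣ᵤ A∣c))
    ∣2c∣≡ : ℤ.∣ c ℤ.+ c ℤ.+ 0ℤ ∣ ≡ 2 * ℤ.∣ c ∣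
    ∣2c∣≡ = trans (cong ℤ.∣_∣ (double c)) (ℤₚ.abs-* (+ 2) c)
      where
      double : ∀ c → c ℤ.+ c ℤ.+ 0ℤ ≡ + 2 ℤ.* c
      double = ℤSolver.solve-∀

  1+D≤D*t² : ∀ t → 2 ≤ t → 1 + D ≤ D * (t * t)
  1+D≤D*t² t 2≤t = begin
    1 + D       ≤⟨ +-monoˡ-≤ D 1≤D ⟩
    D + D       ≡⟨ cong (λ k → D + k) (*-identityʳ D) ⟨
    D + D * 1   ≡⟨ *-suc D 1 ⟨
    D * 2       ≤⟨ *-monoʳ-≤ D (≤-trans 2≤t (m≤m*n t t {{>-nonZero (≤-trans (s≤s z≤n) 2≤t)}})) ⟩
    D * (t * t) ∎
    where open ≤-Reasoning

  1+D≤norm4 : ∀ c y → + A ℤ∣.∣ c → (c , y) ≢ zeroO →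
              1 + D ≤ ∣ c ℤ.+ c ℤ.+ y ∣² + D * ∣ y ∣²
  1+D≤norm4 c (+ 0) A∣c x≢0 =
    ≤-trans (A∣c⇒1+D≤∣2c∣² A∣c (x≢0 ∘ cong (_, 0ℤ))) (m≤m+n _ _)
  1+D≤norm4 c (+ 1)           _ _ = +-mono-≤ (∣y∣≡1⇒1≤∣2c+y∣² c (+ 1) refl) (≤-reflexive (sym (*-identityʳ D)))
  1+D≤norm4 c ℤ.-[1+ 0 ]      _ _ = +-mono-≤ (∣y∣≡1⇒1≤∣2c+y∣² c ℤ.-[1+ 0 ] refl) (≤-reflexive (sym (*-identityʳ D)))
  1+D≤norm4 c (+ (2+ n))      _ _ = ≤-trans (1+D≤D*t² (2+ n) (s≤s (s≤s z≤n))) (m≤n+m _ _)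
  1+D≤norm4 c ℤ.-[1+ suc n ]  _ _ = ≤-trans (1+D≤D*t² (2+ n) (s≤s (s≤s z≤n))) (m≤n+m _ _)

  norm4≡1+D⇒minimal : ∀ {x} → Aℤ+ℤω x → x ≢ zeroO → norm4 D x ≡ + (1 + D) → Minimal D Aℤ+ℤω x
  norm4≡1+D⇒minimal x∈I x≢0 ‖x‖≡ = x∈I , x≢0 , λ where
    (c , y) z∈I z≢0 → subst₂ ℤ._≤_ (sym ‖x‖≡) (sym (norm4≡ D c y)) (ℤ.+≤+ (1+D≤norm4 c y z∈I z≢0))

  Aℤ+ℤω-WR : WR D Aℤ+ℤω
  Aℤ+ℤω-WR = (+ A , 0ℤ) , (0ℤ , + 1)
    , norm4≡1+D⇒minimal ℤ∣.∣-refl (≢-nonZero⁻¹ A ∘ ℤₚ.+-injective ∘ cong proj₁) ‖A‖≡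
    , norm4≡1+D⇒minimal (ℤ∣.divides 0ℤ refl) (λ ()) ‖ω‖≡
    , independent
    where
    ‖A‖≡ : norm4 D (+ A , 0ℤ) ≡ + (1 + D)
    ‖A‖≡ = trans (norm4≡ D (+ A) 0ℤ) (cong +_ (trans (identity A D) (sym 1+D≡4A²)))
      where
      identity : ∀ A D → (A + A + 0) * (A + A + 0) + D * (0 * 0) ≡ 4 * (A * A)
      identity = solve-∀
    ‖ω‖≡ : norm4 D (0ℤ , + 1) ≡ + (1 + D)
    ‖ω‖≡ = trans (norm4≡ D 0ℤ (+ 1)) (cong (λ k → + (1 + k)) (*-identityʳ D))
    independent : Independent (+ A , 0ℤ) (0ℤ , + 1)
    independent det≡0 = ≢-nonZero⁻¹ A (ℤₚ.+-injective (begin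
      + A                         ≡⟨ ℤₚ.+-identityʳ (+ A) ⟨
      + A ℤ.+ 0ℤ                  ≡⟨ cong (ℤ._+ 0ℤ) (ℤₚ.*-identityʳ (+ A)) ⟨
      + A ℤ.* + 1 ℤ.- 0ℤ ℤ.* 0ℤ   ≡⟨ det≡0 ⟩
      0ℤ                          ∎))
      where open ≡-Reasoning

  negCong1Mod4∧wellRoundedIdeal : NegCong1Mod4 D × Σ (OK → Set) (λ I → IsNonzeroIdeal D I × WR D I)
  negCong1Mod4∧wellRoundedIdeal = negCong1Mod4 , Aℤ+ℤω , Aℤ+ℤω-isNonzeroIdeal , Aℤ+ℤω-WR

1+oddPair≡4A² : ∀ a → 1 + (1 + 2 * a) * (3 + 2 * a) ≡ 4 * ((1 + a) * (1 + a))
1+oddPair≡4A² = solve-∀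

≤⇒<oddPair : ∀ {N a} → N ≤ a → N < (1 + 2 * a) * (3 + 2 * a)
≤⇒<oddPair {a = a} N≤a = ≤-trans (s≤s (≤-trans N≤a (m≤m+n a (a + 0)))) (m≤m*n (1 + 2 * a) (3 + 2 * a))

1<oddPair : ∀ a → 1 < (1 + 2 * a) * (3 + 2 * a)
1<oddPair a = ≤-trans (s≤s (s≤s z≤n)) (m≤n*m (3 + 2 * a) (1 + 2 * a))

lemma2p6 : ∀ (N : ℕ) → ∃[ D ] (N < D × 1 < D × SquareFree D × NegCong1Mod4 D ×
    Σ (OK → Set) (λ I → IsNonzeroIdeal D I × WR D I))
lemma2p6 N = case ∃-squareFree-oddPair N of λ where
  (a , N≤a , squareFree) → (1 + 2 * a) * (3 + 2 * a) , ≤⇒<oddPair N≤a , 1<oddPair a , squareFree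
                         , negCong1Mod4∧wellRoundedIdeal {A = 1 + a} (1+oddPair≡4A² a)
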